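{- Let $\mathcal{S}\subseteq 2^{[n]}$ be a Sperner family and $A\subseteq[n]$ a fixed set, and let $h_A:\mathcal{S}\to 2^{[n]}$ be $h_A(S)=S\cap A$. Then $\mathcal{F}=\mathcal{F}(\mathcal{S},h_A)$ is s-extremal and $\mathrm{Sh}(\mathcal{F})=\mathcal{H}(\mathcal{S})$.
   Context: $[n]=\{1,\dots,n\}$. A family $\mathcal{F}\subseteq 2^{[n]}$ shatters $S\subseteq[n]$ if $\{F\cap S: F\in\mathcal{F}\}=2^S$; $\mathrm{Sh}(\mathcal{F})$ is the family of sets shattered by $\mathcal{F}$. $\mathcal{F}$ is s-extremal if $|\mathrm{Sh}(\mathcal{F})|=|\mathcal{F}|$. A Sperner family is a family none of whose members contains another. For $H\subseteq S\subseteq[n]$ let $\mathcal{P}_S=\{S\cup B: B\subseteq [n]\setminus S\}$ and $\mathcal{Q}_{S,H}=\{H\cup B: B\subseteq[n]\setminus S\}$. Define $\mathcal{H}(\mathcal{S})=2^{[n]}\setminus\bigcup_{S\in\mathcal{S}}\mathcal{P}_S$ and $\mathcal{F}(\mathcal{S},h)=2^{[n]}\setminus\bigcup_{S\in\mathcal{S}}\mathcal{Q}_{S,h(S)}$. -}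

module Defs where

open import Data.Nat using (ℕ; zero; suc)
open import Data.Bool using (Bool; true; false; _∧_; _∨_; not)
open import Data.Vec using (Vec; []; _∷_)
open import Data.List using (List; []; _∷_; _++_; map; filter; length)
open import Data.Bool.ListAction using (all; any)
open import Data.Fin.Subset using (Subset; _∩_; _∪_; _⊆_; ∁)
open import Data.Fin.Subset.Properties using (_⊆?_)
open import Data.Vec.Properties using (≡-dec)
import Data.Bool.Properties as BP
open import Relation.Nullary.Decidable using (⌊_⌋)
open import Relation.Binary.PropositionalEquality using (_≡_)

Family : ℕ → Set
Family n = Subset n → Bool

allSubsets : (n : ℕ) → List (Subset n)
allSubsets zero = [] ∷ []
allSubsets (suc n) = map (false ∷_) (allSubsets n) ++ map (true ∷_) (allSubsets n)

card : {n : ℕ} → Family n → ℕ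
card {n} F = length (filter (λ X → F X ≡? true) (allSubsets n))
  where
  open import Data.Bool.Properties renaming (_≟_ to _≡?_)

_⊆ᵇ_ : {n : ℕ} → Subset n → Subset n → Bool
A ⊆ᵇ B = ⌊ A ⊆? B ⌋

_≡ᵇ_ : {n : ℕ} → Subset n → Subset n → Bool
A ≡ᵇ B = ⌊ ≡-dec BP._≟_ A B ⌋

-- 𝓕 shatters S : every T ⊆ S is of the form F ∩ S with F ∈ 𝓕
-- (the inclusion {F ∩ S} ⊆ 2^S is automatic).
shatters : {n : ℕ} → Family n → Subset n → Bool
shatters {n} F S =
  all (λ T → not (T ⊆ᵇ S) ∨ any (λ X → F X ∧ ((X ∩ S) ≡ᵇ T)) (allSubsets n))
      (allSubsets n)

Sh : {n : ℕ} → Family n → Family n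
Sh F S = shatters F S

SExtremal : {n : ℕ} → Family n → Set
SExtremal F = card (Sh F) ≡ card F

Sperner : {n : ℕ} → Family n → Set
Sperner 𝓢 = ∀ S T → 𝓢 S ≡ true → 𝓢 T ≡ true → S ⊆ T → S ≡ T

inP : {n : ℕ} → Subset n → Subset n → Bool
inP S X = S ⊆ᵇ X

inQ : {n : ℕ} → Subset n → Subset n → Subset n → Bool
inQ {n} S H X = any (λ B → (B ⊆ᵇ ∁ S) ∧ (X ≡ᵇ (H ∪ B))) (allSubsets n)

𝓗 : {n : ℕ} → Family n → Family n
𝓗 {n} 𝓢 X = not (any (λ S → 𝓢 S ∧ inP S X) (allSubsets n))

𝓕 : {n : ℕ} → Family n → (Subset n → Subset n) → Family n
𝓕 {n} 𝓢 h X = not (any (λ S → 𝓢 S ∧ inQ S (h S) X) (allSubsets n))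

module Submission where

-- For sets Y, a ⊆ [n] let  agree Y a  be the set of
-- coordinates on which Y and a agree, i.e. the complement of Y △ a.
-- A set Y lies in 𝓠_{S,S∩A} exactly when its trace on S is S ∩ A, that
-- is, when S ⊆ agree Y A.  Hence Y ∈ 𝓕(𝓢,h_A) iff agree Y A ∈ 𝓗(𝓢):
-- 𝓕(𝓢,h_A) is the image of 𝓗(𝓢) under the involution Y ↦ agree Y A.
-- The family 𝓗(𝓢) is closed downwards, and for every down-closed family
-- D the "translate" {Y | agree Y a ∈ D} shatters exactly the members of D.
-- Since Y ↦ agree Y a is a bijection, |𝓕| = |𝓗| = |Sh 𝓕|.

open import Defs
open import Data.Nat using (ℕ; suc; _+_)
open import Data.Nat.Properties using (+-comm)
open import Data.Product using (_×_; _,_; ∃-syntax)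
open import Data.Bool using (Bool; true; false; T; not; _∧_; _∨_; _xor_)
open import Data.Bool.Properties using (T-∧; T-∨) renaming (_≟_ to _≟ᵇ_)
open import Data.Bool.ListAction using (any; all; or)
open import Data.Unit using (tt)
open import Data.Empty using (⊥-elim)
open import Data.Sum using (inj₁; inj₂)
open import Data.Vec using ([]; _∷_; zipWith; here)
open import Data.Vec.Properties using (∷-injectiveˡ; ∷-injectiveʳ)
open import Data.List using (List; []; _∷_; _++_; map; filter; length)
open import Data.List.Properties using (map-cong; length-++; filter-++; filter-≐)
open import Data.List.Membership.Propositional using (_∈_; lose)
open import Data.List.Membership.Propositional.Properties using (∈-++⁺ˡ; ∈-++⁺ʳ; ∈-map⁺)
import Data.List.Relation.Unary.Any as Any
open import Data.List.Relation.Unary.Any.Properties using (any⁺; any⁻)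
open import Data.List.Relation.Unary.All using (tabulate; lookup)
open import Data.List.Relation.Unary.All.Properties using (all⁺; all⁻)
open import Data.Fin.Subset using (Subset; _∩_; _∪_; ∁; _⊆_)
open import Data.Fin.Subset.Properties using (_⊆?_; ⊆-trans; p∩q⊆p; p∩q⊆q; ∩-comm; out⊆; in⊆in; drop-∷-⊆)
open import Function.Bundles using (_⇔_; mk⇔; Equivalence)
open import Relation.Nullary using (¬_; yes; no)
open import Relation.Nullary.Decidable using (toWitness; fromWitness)
open import Relation.Binary.PropositionalEquality using (_≡_; refl; sym; trans; cong; cong₂; subst; module ≡-Reasoning)

open Equivalence using (to; from)

T-ext : ∀ {a b} → (T a → T b) → (T b → T a) → a ≡ b
T-ext {false} {false} _   _   = refl
T-ext {false} {true}  _   b⇒a = ⊥-elim (b⇒a tt)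
T-ext {true}  {false} a⇒b _   = ⊥-elim (a⇒b tt)
T-ext {true}  {true}  _   _   = refl

T-not⁺ : ∀ {b} → ¬ T b → T (not b)
T-not⁺ {false} _  = tt
T-not⁺ {true}  ¬b = ¬b tt

T-not⁻ : ∀ {b} → T (not b) → ¬ T b
T-not⁻ {false} _ ()
T-not⁻ {true}  ()

∈-allSubsets : ∀ {n} (X : Subset n) → X ∈ allSubsets n
∈-allSubsets []                = Any.here refl
∈-allSubsets {suc n} (false ∷ X) = ∈-++⁺ˡ (∈-map⁺ (false ∷_) (∈-allSubsets X))
∈-allSubsets {suc n} (true ∷ X)  =
  ∈-++⁺ʳ (map (false ∷_) (allSubsets n)) (∈-map⁺ (true ∷_) (∈-allSubsets X))

any-allSubsets⁺ : ∀ {n} (p : Subset n → Bool) X → T (p X) → T (any p (allSubsets n))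
any-allSubsets⁺ p X pX = any⁺ p (lose (∈-allSubsets X) pX)

any-allSubsets⁻ : ∀ {n} (p : Subset n → Bool) → T (any p (allSubsets n)) → ∃[ X ] T (p X)
any-allSubsets⁻ {n} p h = Any.satisfied (any⁻ p (allSubsets n) h)

all-allSubsets⁺ : ∀ {n} (p : Subset n → Bool) → (∀ X → T (p X)) → T (all p (allSubsets n))
all-allSubsets⁺ {n} p ∀p = all⁻ p {allSubsets n} (tabulate (λ {X} _ → ∀p X))

all-allSubsets⁻ : ∀ {n} (p : Subset n → Bool) → T (all p (allSubsets n)) → ∀ X → T (p X)
all-allSubsets⁻ {n} p h X = lookup (all⁺ p (allSubsets n) h) (∈-allSubsets X)

any-cong : ∀ {A : Set} {p q : A → Bool} → (∀ x → p x ≡ q x) → ∀ xs → any p xs ≡ any q xs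
any-cong p≗q xs = cong or (map-cong p≗q xs)

_⇔ᵇ_ : Bool → Bool → Bool
x ⇔ᵇ y = not (x xor y)

agree : ∀ {n} → Subset n → Subset n → Subset n
agree = zipWith _⇔ᵇ_

⊆-head : ∀ {n x y} {p q : Subset n} → x ∷ p ⊆ y ∷ q → T x → T y
⊆-head {x = true} {y = true}  _   _ = tt
⊆-head {x = true} {y = false} x⊆y _ with x⊆y here
... | ()

⊆-∷ : ∀ {n x y} {p q : Subset n} → (T x → T y) → p ⊆ q → x ∷ p ⊆ y ∷ q
⊆-∷ {x = false}             _   p⊆q = out⊆ p⊆q
⊆-∷ {x = true} {y = true}  _   p⊆q = in⊆in p⊆q
⊆-∷ {x = true} {y = false} x⇒y _   = ⊥-elim (x⇒y tt)

∪-∩-absorb : ∀ {n} {H S B : Subset n} → H ⊆ S → B ⊆ ∁ S → (H ∪ B) ∩ S ≡ H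
∪-∩-absorb {H = []} {[]} {[]} _ _ = refl
∪-∩-absorb {H = h ∷ _} {s ∷ _} {b ∷ _} H⊆S B⊆∁S =
  cong₂ _∷_ (at h s b (⊆-head H⊆S) (⊆-head B⊆∁S)) (∪-∩-absorb (drop-∷-⊆ H⊆S) (drop-∷-⊆ B⊆∁S))
  where
  at : ∀ h s b → (T h → T s) → (T b → T (not s)) → (h ∨ b) ∧ s ≡ h
  at false false false _   _    = refl
  at false false true  _   _    = refl
  at false true  false _   _    = refl
  at false true  true  _   b⇒¬s = ⊥-elim (b⇒¬s tt)
  at true  false _     h⇒s _    = ⊥-elim (h⇒s tt)
  at true  true  _     _   _    = refl

∩-∪-∩∁ : ∀ {n} (X S : Subset n) → (X ∩ S) ∪ (X ∩ ∁ S) ≡ X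
∩-∪-∩∁ []      []      = refl
∩-∪-∩∁ (x ∷ X) (s ∷ S) = cong₂ _∷_ (at x s) (∩-∪-∩∁ X S)
  where
  at : ∀ x s → (x ∧ s) ∨ (x ∧ not s) ≡ x
  at false _     = refl
  at true  false = refl
  at true  true  = refl

agree-⊆⇒ : ∀ {n} {S X a : Subset n} → S ⊆ agree X a → X ∩ S ≡ a ∩ S
agree-⊆⇒ {S = []} {[]} {[]} _ = refl
agree-⊆⇒ {S = s ∷ _} {x ∷ _} {y ∷ _} S⊆ =
  cong₂ _∷_ (at s x y (⊆-head S⊆)) (agree-⊆⇒ (drop-∷-⊆ S⊆))
  where
  at : ∀ s x y → (T s → T (x ⇔ᵇ y)) → x ∧ s ≡ y ∧ s
  at false false false _ = refl
  at false false true  _ = refl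
  at false true  false _ = refl
  at false true  true  _ = refl
  at true  false false _ = refl
  at true  true  true  _ = refl
  at true  false true  s⇒ = ⊥-elim (s⇒ tt)
  at true  true  false s⇒ = ⊥-elim (s⇒ tt)

agree-⊆⇐ : ∀ {n} {S X a : Subset n} → X ∩ S ≡ a ∩ S → S ⊆ agree X a
agree-⊆⇐ {S = []} {[]} {[]} _ ()
agree-⊆⇐ {S = s ∷ _} {x ∷ _} {y ∷ _} eq =
  ⊆-∷ (at s x y (∷-injectiveˡ eq)) (agree-⊆⇐ (∷-injectiveʳ eq))
  where
  at : ∀ s x y → x ∧ s ≡ y ∧ s → T s → T (x ⇔ᵇ y)
  at true false false _ _ = tt
  at true true  true  _ _ = tt

agree-off-⊆ : ∀ {n} {U S a : Subset n} → U ⊆ S → agree (U ∪ (∁ a ∩ ∁ S)) a ⊆ S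
agree-off-⊆ {U = []} {[]} {[]} _ ()
agree-off-⊆ {U = u ∷ _} {s ∷ _} {y ∷ _} U⊆S =
  ⊆-∷ (at u s y (⊆-head U⊆S)) (agree-off-⊆ (drop-∷-⊆ U⊆S))
  where
  at : ∀ u s y → (T u → T s) → T ((u ∨ (not y ∧ not s)) ⇔ᵇ y) → T s
  at _     true  _     _   _ = tt
  at true  false _     u⇒s _ = u⇒s tt
  at false false false _   ()
  at false false true  _   ()

⊆ᵇ⁺ : ∀ {n} {A B : Subset n} → A ⊆ B → T (A ⊆ᵇ B)
⊆ᵇ⁺ A⊆B = fromWitness (λ {x} → A⊆B {x})

⊆ᵇ⁻ : ∀ {n} {A B : Subset n} → T (A ⊆ᵇ B) → A ⊆ B
⊆ᵇ⁻ = toWitness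

≡ᵇ⁺ : ∀ {n} {A B : Subset n} → A ≡ B → T (A ≡ᵇ B)
≡ᵇ⁺ = fromWitness

≡ᵇ⁻ : ∀ {n} {A B : Subset n} → T (A ≡ᵇ B) → A ≡ B
≡ᵇ⁻ = toWitness

Shatters : ∀ {n} → Family n → Subset n → Set
Shatters F S = ∀ {U} → U ⊆ S → ∃[ X ] T (F X) × X ∩ S ≡ U

shatters⇒Shatters : ∀ {n} (F : Family n) S → T (shatters F S) → Shatters F S
shatters⇒Shatters F S h {U} U⊆S
  with to T-∨ (all-allSubsets⁻ _ h U)
... | inj₁ U⊈S = ⊥-elim (T-not⁻ U⊈S (⊆ᵇ⁺ U⊆S))
... | inj₂ trace with any-allSubsets⁻ _ trace
...   | X , X∈F∧X∩S≡U with to T-∧ X∈F∧X∩S≡U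
...     | X∈F , X∩S≡U = X , X∈F , ≡ᵇ⁻ X∩S≡U

Shatters⇒shatters : ∀ {n} (F : Family n) S → Shatters F S → T (shatters F S)
Shatters⇒shatters F S sh = all-allSubsets⁺ _ traceOf
  where
  traceOf : ∀ U → T (not (U ⊆ᵇ S) ∨ any (λ X → F X ∧ ((X ∩ S) ≡ᵇ U)) (allSubsets _))
  traceOf U with U ⊆? S
  ... | no  _   = tt
  ... | yes U⊆S with sh U⊆S
  ...   | X , X∈F , X∩S≡U = any-allSubsets⁺ _ X (from T-∧ (X∈F , ≡ᵇ⁺ X∩S≡U))

inQ⇔trace : ∀ {n} {S H : Subset n} Y → H ⊆ S → T (inQ S H Y) ⇔ Y ∩ S ≡ H
inQ⇔trace {S = S} {H} Y H⊆S = mk⇔ traceIsH fromTrace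
  where
  traceIsH : T (inQ S H Y) → Y ∩ S ≡ H
  traceIsH h with any-allSubsets⁻ (λ B → (B ⊆ᵇ ∁ S) ∧ (Y ≡ᵇ (H ∪ B))) h
  ... | B , B⊆∁S∧Y≡H∪B with to T-∧ B⊆∁S∧Y≡H∪B
  ...   | B⊆∁S , Y≡H∪B =
    trans (cong (_∩ S) (≡ᵇ⁻ Y≡H∪B)) (∪-∩-absorb H⊆S (⊆ᵇ⁻ B⊆∁S))
  fromTrace : Y ∩ S ≡ H → T (inQ S H Y)
  fromTrace Y∩S≡H = any-allSubsets⁺ (λ B → (B ⊆ᵇ ∁ S) ∧ (Y ≡ᵇ (H ∪ B))) (Y ∩ ∁ S)
    (from T-∧ (⊆ᵇ⁺ (p∩q⊆q Y (∁ S)) , ≡ᵇ⁺ Y≡H∪Y∩∁S))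
    where
    open ≡-Reasoning
    Y≡H∪Y∩∁S : Y ≡ H ∪ (Y ∩ ∁ S)
    Y≡H∪Y∩∁S = begin
      Y                         ≡⟨ sym (∩-∪-∩∁ Y S) ⟩
      (Y ∩ S) ∪ (Y ∩ ∁ S)       ≡⟨ cong (_∪ (Y ∩ ∁ S)) Y∩S≡H ⟩
      H ∪ (Y ∩ ∁ S)             ∎

inQ-hA≡inP-agree : ∀ {n} (S A Y : Subset n) → inQ S (S ∩ A) Y ≡ inP S (agree Y A)
inQ-hA≡inP-agree S A Y = T-ext
  (λ Y∈Q → ⊆ᵇ⁺ (agree-⊆⇐ (trans (to trace Y∈Q) (∩-comm S A))))
  (λ Y∈P → from trace (trans (agree-⊆⇒ (⊆ᵇ⁻ Y∈P)) (∩-comm A S)))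
  where
  trace : T (inQ S (S ∩ A) Y) ⇔ Y ∩ S ≡ S ∩ A
  trace = inQ⇔trace Y (p∩q⊆p S A)

𝓕-hA≡𝓗-agree : ∀ {n} (𝓢 : Family n) (A Y : Subset n) →
  𝓕 𝓢 (λ S → S ∩ A) Y ≡ 𝓗 𝓢 (agree Y A)
𝓕-hA≡𝓗-agree {n} 𝓢 A Y =
  cong not (any-cong (λ S → cong (𝓢 S ∧_) (inQ-hA≡inP-agree S A Y)) (allSubsets n))

DownClosed : ∀ {n} → Family n → Set
DownClosed D = ∀ {X Y} → X ⊆ Y → T (D Y) → T (D X)

𝓗-downClosed : ∀ {n} (𝓢 : Family n) → DownClosed (𝓗 𝓢)
𝓗-downClosed 𝓢 {X} {Y} X⊆Y Y∈𝓗 = T-not⁺ λ X∉𝓗 →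
  let S , S∈𝓢∧S⊆X = any-allSubsets⁻ (λ S → 𝓢 S ∧ inP S X) X∉𝓗
      S∈𝓢 , S⊆X = to (T-∧ {𝓢 S}) S∈𝓢∧S⊆X
  in T-not⁻ Y∈𝓗 (any-allSubsets⁺ (λ S → 𝓢 S ∧ inP S Y) S
                   (from (T-∧ {𝓢 S}) (S∈𝓢 , ⊆ᵇ⁺ (⊆-trans (⊆ᵇ⁻ S⊆X) X⊆Y))))

Sh-translate : ∀ {n} (D G : Family n) (a : Subset n) → DownClosed D →
  (∀ Y → G Y ≡ D (agree Y a)) → ∀ S → Sh G S ≡ D S
Sh-translate D G a down G≡D S =
  T-ext (λ sh → shattered⇒∈D (shatters⇒Shatters G S sh))
        (λ S∈D → Shatters⇒shatters G S (∈D⇒shattered S∈D))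
  where
  -- The trace a ∩ S is realised by some X ∈ G, which then agrees with a on S.
  shattered⇒∈D : Shatters G S → T (D S)
  shattered⇒∈D sh with sh (p∩q⊆q a S)
  ... | X , X∈G , X∩S≡a∩S =
    down (agree-⊆⇐ X∩S≡a∩S) (subst T (G≡D X) X∈G)
  -- The trace U ⊆ S is realised by U ∪ (∁a ∩ ∁S), which agrees with a only inside S.
  ∈D⇒shattered : T (D S) → Shatters G S
  ∈D⇒shattered S∈D {U} U⊆S =
    U ∪ (∁ a ∩ ∁ S) ,
    subst T (sym (G≡D _)) (down (agree-off-⊆ U⊆S) S∈D) ,
    ∪-∩-absorb U⊆S (p∩q⊆q (∁ a) (∁ S))

count : ∀ {n} → Family n → List (Subset n) → ℕ
count F xs = length (filter (λ X → F X ≟ᵇ true) xs)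

count-++ : ∀ {n} (F : Family n) xs ys → count F (xs ++ ys) ≡ count F xs + count F ys
count-++ F xs ys = trans (cong length (filter-++ (λ X → F X ≟ᵇ true) xs ys)) (length-++ (filter (λ X → F X ≟ᵇ true) xs))

count-map : ∀ {m n} (F : Family n) (f : Subset m → Subset n) xs →
  count F (map f xs) ≡ count (λ X → F (f X)) xs
count-map F f []       = refl
count-map F f (x ∷ xs) with F (f x)
... | true  = cong suc (count-map F f xs)
... | false = count-map F f xs

card-split : ∀ {n} (F : Family (suc n)) →
  card F ≡ card (λ X → F (false ∷ X)) + card (λ X → F (true ∷ X))
card-split {n} F = begin
  count F (map (false ∷_) (allSubsets n) ++ map (true ∷_) (allSubsets n))
    ≡⟨ count-++ F (map (false ∷_) (allSubsets n)) (map (true ∷_) (allSubsets n)) ⟩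
  count F (map (false ∷_) (allSubsets n)) + count F (map (true ∷_) (allSubsets n))
    ≡⟨ cong₂ _+_ (count-map F (false ∷_) (allSubsets n)) (count-map F (true ∷_) (allSubsets n)) ⟩
  card (λ X → F (false ∷ X)) + card (λ X → F (true ∷ X)) ∎
  where open ≡-Reasoning

card-cong : ∀ {n} {F G : Family n} → (∀ X → F X ≡ G X) → card F ≡ card G
card-cong {n} {F} {G} F≗G =
  cong length (filter-≐ (λ X → F X ≟ᵇ true) (λ X → G X ≟ᵇ true)
                        ((λ {X} → trans (sym (F≗G X))) , (λ {X} → trans (F≗G X)))
                        (allSubsets n))

-- Y ↦ agree Y a is a bijection of 2^[n], so translating preserves size.
card-agree : ∀ {n} (D : Family n) (a : Subset n) → card (λ Y → D (agree Y a)) ≡ card D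
card-agree D []          = card-cong {F = λ Y → D (agree Y [])} {G = D} λ { [] → refl }
card-agree D (true ∷ a)  = begin
  card (λ Y → D (agree Y (true ∷ a)))
    ≡⟨ card-split (λ Y → D (agree Y (true ∷ a))) ⟩
  card (λ Y → D (false ∷ agree Y a)) + card (λ Y → D (true ∷ agree Y a))
    ≡⟨ cong₂ _+_ (card-agree (λ X → D (false ∷ X)) a) (card-agree (λ X → D (true ∷ X)) a) ⟩
  card (λ X → D (false ∷ X)) + card (λ X → D (true ∷ X))
    ≡⟨ sym (card-split D) ⟩
  card D ∎
  where open ≡-Reasoning
card-agree D (false ∷ a) = begin
  card (λ Y → D (agree Y (false ∷ a)))
    ≡⟨ card-split (λ Y → D (agree Y (false ∷ a))) ⟩
  card (λ Y → D (true ∷ agree Y a)) + card (λ Y → D (false ∷ agree Y a))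
    ≡⟨ cong₂ _+_ (card-agree (λ X → D (true ∷ X)) a) (card-agree (λ X → D (false ∷ X)) a) ⟩
  card (λ X → D (true ∷ X)) + card (λ X → D (false ∷ X))
    ≡⟨ +-comm (card (λ X → D (true ∷ X))) _ ⟩
  card (λ X → D (false ∷ X)) + card (λ X → D (true ∷ X))
    ≡⟨ sym (card-split D) ⟩
  card D ∎
  where open ≡-Reasoning

proposition14 : (n : ℕ) (𝓢 : Family n) (A : Subset n) →
    Sperner 𝓢 →
    SExtremal (𝓕 𝓢 (λ S → S ∩ A)) × (∀ X → Sh (𝓕 𝓢 (λ S → S ∩ A)) X ≡ 𝓗 𝓢 X)
proposition14 n 𝓢 A _ = extremal , Sh𝓕≡𝓗
  where
  𝓕ₐ : Family n
  𝓕ₐ = 𝓕 𝓢 (λ S → S ∩ A)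

  Sh𝓕≡𝓗 : ∀ X → Sh 𝓕ₐ X ≡ 𝓗 𝓢 X
  Sh𝓕≡𝓗 = Sh-translate (𝓗 𝓢) 𝓕ₐ A (𝓗-downClosed 𝓢) (𝓕-hA≡𝓗-agree 𝓢 A)

  extremal : card (Sh 𝓕ₐ) ≡ card 𝓕ₐ
  extremal = begin
    card (Sh 𝓕ₐ)                      ≡⟨ card-cong Sh𝓕≡𝓗 ⟩
    card (𝓗 𝓢)                        ≡⟨ sym (card-agree (𝓗 𝓢) A) ⟩
    card (λ Y → 𝓗 𝓢 (agree Y A))      ≡⟨ sym (card-cong (𝓕-hA≡𝓗-agree 𝓢 A)) ⟩
    card 𝓕ₐ                           ∎
    where open ≡-Reasoning
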